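{- Let $D\ge 3$ be an integer and let $\mathcal I=\{(i,j,t)\in\mathbb Z^3: 0\le t\le i,j\le D,\ i+j-t\le 2D-2,\ t\ge\lfloor (j+1)/2\rfloor \text{ if } i=D,\ t\ge\lfloor (i+1)/2\rfloor\text{ if } j=D\}$. Then $|\mathcal I|=\frac{(D+1)(D^2+2D+3)}{3}$.
   Context: The set $\mathcal I$ is the set of triples $(i,j,t)$ arising as distance data of ordered vertex triples in the folded $2D$-cube; the claim is purely combinatorial. -}

module Defs where

open import Data.Nat using (ℕ; suc; _+_; _*_; _∸_; _≤_; _/_; _≟_; _≤?_)
open import Data.Product using (_×_; _,_)
open import Data.List using (List; filter; upTo; concatMap; length; [_])
open import Relation.Binary.PropositionalEquality using (_≡_)
open import Relation.Nullary using (Dec; ¬_)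
open import Relation.Nullary.Decidable using (_×-dec_; _→-dec_)

-- Membership in the index set 𝓘 (for a fixed D).  Since 0 ≤ t, all of
-- i, j, t are natural numbers, so we work over ℕ.  The term i + j ∸ t is
-- the genuine integer i + j - t because t ≤ i.
InI : ℕ → ℕ × ℕ × ℕ → Set
InI D (i , j , t) =
  (t ≤ i) × (t ≤ j) × (i ≤ D) × (j ≤ D) × (i + j ∸ t ≤ 2 * D ∸ 2)
  × ((i ≡ D) → (suc j / 2 ≤ t))
  × ((j ≡ D) → (suc i / 2 ≤ t))

InI? : (D : ℕ) → (x : ℕ × ℕ × ℕ) → Dec (InI D x)
InI? D (i , j , t) =
  (t ≤? i) ×-dec (t ≤? j) ×-dec (i ≤? D) ×-dec (j ≤? D) ×-dec (i + j ∸ t ≤? 2 * D ∸ 2)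
  ×-dec ((i ≟ D) →-dec (suc j / 2 ≤? t))
  ×-dec ((j ≟ D) →-dec (suc i / 2 ≤? t))

-- All triples in {0..D}^3 (each listed exactly once); every element of 𝓘 is among them.
box : ℕ → List (ℕ × ℕ × ℕ)
box D = concatMap (λ i → concatMap (λ j → concatMap (λ t → [ (i , j , t) ]) (upTo (suc D))) (upTo (suc D))) (upTo (suc D))

𝓘 : ℕ → List (ℕ × ℕ × ℕ)
𝓘 D = filter (InI? D) (box D)

module Submission where

-- The index set 𝓘 is listed as the filter of the box {0..D}³, so |𝓘| is a
-- triple sum over (i , j , t) of the indicator of membership.  For fixed
-- (i , j) the admissible t always form an interval, whose length we read off:
--
--   * interior  i , j < D :   0 ≤ t ≤ min(i , j)          → min(i , j) + 1,
--   * edge      i = D > j :   ⌈j/2⌉ ≤ t ≤ j                → ⌊j/2⌋ + 1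
--     (the case j = D > i is the same by the symmetry i ↔ j of 𝓘),
--   * corner    i = j = D :   ⌈D/2⌉ ≤ t ≤ D                → ⌊D/2⌋ + 1.
--
-- The condition i + j - t ≤ 2D - 2 is automatic in every case once D ≥ 3.
-- Hence |𝓘| = Σ_{i,j<D} (min(i,j)+1) + 2 Σ_{j<D} (⌊j/2⌋+1) + ⌊D/2⌋ + 1, and
-- the two sums have the closed forms D(D+1)(2D+1)/6 and (D²+3D-2⌊D/2⌋)/4,
-- which add up to the claimed (D+1)(D²+2D+3)/3.

open import Defs
open import Data.Nat using (ℕ; _≤_; _*_; _+_)
open import Data.List using (length)
open import Relation.Binary.PropositionalEquality using (_≡_)

open import Data.Nat using (zero; suc; _∸_; _<_; _/_; _⊓_; ⌊_/2⌋; ⌈_/2⌉; _≤?_; z≤n; s≤s; s≤s⁻¹)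
open import Data.Nat.Properties
open import Data.Nat.DivMod using (m/n≡1+[m∸n]/n)
open import Data.Nat.Tactic.RingSolver using (solve-∀)
open import Data.Product using (_×_; _,_)
open import Data.Sum using (inj₁; inj₂)
open import Data.List using (List; []; _++_; filter; upTo; concatMap; [_])
open import Data.List.Properties using (filter-++; length-++; upTo-∷ʳ; concatMap-++; ++-identityʳ)
open import Data.Empty using (⊥-elim)
open import Function.Bundles using (_⇔_; mk⇔; Equivalence)
open import Relation.Binary.PropositionalEquality using (refl; sym; trans; cong; cong₂; subst; module ≡-Reasoning)
open import Relation.Nullary using (Dec; yes; no)
open import Relation.Nullary.Decidable using (_×-dec_)
open import Relation.Unary using (Pred; Decidable)

open ≡-Reasoning

Σ< : ℕ → (ℕ → ℕ) → ℕ
Σ< zero    f = 0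
Σ< (suc n) f = Σ< n f + f n

Σ<-cong : ∀ n {f g : ℕ → ℕ} → (∀ k → k < n → f k ≡ g k) → Σ< n f ≡ Σ< n g
Σ<-cong zero    f≗g = refl
Σ<-cong (suc n) f≗g = cong₂ _+_ (Σ<-cong n (λ k k<n → f≗g k (m<n⇒m<1+n k<n))) (f≗g n ≤-refl)

Σ<-+ : ∀ n (f g : ℕ → ℕ) → Σ< n (λ k → f k + g k) ≡ Σ< n f + Σ< n g
Σ<-+ zero    f g = refl
Σ<-+ (suc n) f g = trans (cong (_+ (f n + g n)) (Σ<-+ n f g)) (interchange (Σ< n f) (Σ< n g) (f n) (g n))
  where
  interchange : ∀ a b c d → a + b + (c + d) ≡ a + c + (b + d)
  interchange = solve-∀

gauss : ∀ n → 2 * Σ< n suc ≡ n * suc n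
gauss zero    = refl
gauss (suc n) = begin
    2 * (Σ< n suc + suc n)    ≡⟨ *-distribˡ-+ 2 (Σ< n suc) (suc n) ⟩
    2 * Σ< n suc + 2 * suc n  ≡⟨ cong (_+ 2 * suc n) (gauss n) ⟩
    n * suc n + 2 * suc n     ≡⟨ step n ⟩
    suc n * suc (suc n)       ∎
  where
  step : ∀ n → n * suc n + 2 * suc n ≡ suc n * suc (suc n)
  step = solve-∀

𝟙 : ∀ {p} {P : Set p} → Dec P → ℕ
𝟙 (yes _) = 1
𝟙 (no _)  = 0

𝟙-⇔ : ∀ {p q} {P : Set p} {Q : Set q} (P? : Dec P) (Q? : Dec Q) → P ⇔ Q → 𝟙 P? ≡ 𝟙 Q?
𝟙-⇔ (yes _) (yes _) P⇔Q = refl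
𝟙-⇔ (yes p) (no ¬q) P⇔Q = ⊥-elim (¬q (Equivalence.to P⇔Q p))
𝟙-⇔ (no ¬p) (yes q) P⇔Q = ⊥-elim (¬p (Equivalence.from P⇔Q q))
𝟙-⇔ (no _)  (no _)  P⇔Q = refl

module Counting {a p} {A : Set a} {P : Pred A p} (P? : Decidable P) where

  count : List A → ℕ
  count xs = length (filter P? xs)

  count-++ : ∀ xs ys → count (xs ++ ys) ≡ count xs + count ys
  count-++ xs ys = trans (cong length (filter-++ P? xs ys)) (length-++ (filter P? xs))

  count-[_] : ∀ x → count [ x ] ≡ 𝟙 (P? x)
  count-[ x ] with P? x
  ... | yes _ = refl
  ... | no _  = refl

  count-concatMap-upTo : (g : ℕ → List A) → ∀ n →
    count (concatMap g (upTo n)) ≡ Σ< n (λ k → count (g k))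
  count-concatMap-upTo g zero    = refl
  count-concatMap-upTo g (suc n) = begin
      count (concatMap g (upTo (suc n)))               ≡⟨ cong (λ ks → count (concatMap g ks)) (sym (upTo-∷ʳ n)) ⟩
      count (concatMap g (upTo n ++ [ n ]))             ≡⟨ cong count (concatMap-++ g (upTo n) [ n ]) ⟩
      count (concatMap g (upTo n) ++ (g n ++ []))       ≡⟨ count-++ (concatMap g (upTo n)) (g n ++ []) ⟩
      count (concatMap g (upTo n)) + count (g n ++ [])  ≡⟨ cong₂ _+_ (count-concatMap-upTo g n) (cong count (++-identityʳ (g n))) ⟩
      Σ< n (λ k → count (g k)) + count (g n)           ∎

open Counting using (count-[_]; count-concatMap-upTo)
inInterval : ℕ → ℕ → ℕ → ℕ
inInterval a b t = 𝟙 ((a ≤? t) ×-dec (t ≤? b))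

count-interval-prefix : ∀ a b n → n ≤ suc b → Σ< n (inInterval a b) ≡ n ∸ a
count-interval-prefix a b zero    _       = sym (0∸n≡0 a)
count-interval-prefix a b (suc n) n<1+b with a ≤? n | n ≤? b
... | _       | no n≰b = ⊥-elim (n≰b (s≤s⁻¹ n<1+b))
... | yes a≤n | yes _  = begin
    Σ< n (inInterval a b) + 1  ≡⟨ cong (_+ 1) (count-interval-prefix a b n (<⇒≤ n<1+b)) ⟩
    n ∸ a + 1                  ≡⟨ +-comm (n ∸ a) 1 ⟩
    1 + (n ∸ a)                ≡⟨ +-∸-assoc 1 a≤n ⟨
    suc n ∸ a                  ∎
... | no a≰n  | yes _  = begin
    Σ< n (inInterval a b) + 0  ≡⟨ +-identityʳ _ ⟩
    Σ< n (inInterval a b)      ≡⟨ count-interval-prefix a b n (<⇒≤ n<1+b) ⟩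
    n ∸ a                      ≡⟨ m≤n⇒m∸n≡0 (<⇒≤ n<a) ⟩
    0                          ≡⟨ m≤n⇒m∸n≡0 n<a ⟨
    suc n ∸ a                  ∎
  where
  n<a : n < a
  n<a = ≰⇒> a≰n

count-interval : ∀ a b n → b < n → Σ< n (inInterval a b) ≡ suc b ∸ a
count-interval a b (suc n) b<1+n with m≤n⇒m<n∨m≡n (s≤s⁻¹ b<1+n)
... | inj₂ refl = count-interval-prefix a b (suc b) ≤-refl
... | inj₁ b<n  = begin
    Σ< n (inInterval a b) + inInterval a b n  ≡⟨ cong₂ _+_ (count-interval a b n b<n) (beyond (n ≤? b)) ⟩
    suc b ∸ a + 0                             ≡⟨ +-identityʳ _ ⟩
    suc b ∸ a                                 ∎
  where
  beyond : (n≤?b : Dec (n ≤ b)) → 𝟙 ((a ≤? n) ×-dec n≤?b) ≡ 0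
  beyond (yes n≤b) = ⊥-elim (<⇒≱ b<n n≤b)
  beyond (no _) with a ≤? n
  ... | yes _ = refl
  ... | no _  = refl

fibre : ℕ → ℕ → ℕ → ℕ
fibre D i j = Σ< (suc D) (λ t → 𝟙 (InI? D (i , j , t)))

length-𝓘 : ∀ D → length (𝓘 D) ≡ Σ< (suc D) (λ i → Σ< (suc D) (fibre D i))
length-𝓘 D =
  trans (count-concatMap-upTo (InI? D) rows (suc D)) (Σ<-cong (suc D) λ i _ →
  trans (count-concatMap-upTo (InI? D) (column i) (suc D)) (Σ<-cong (suc D) λ j _ →
  trans (count-concatMap-upTo (InI? D) (point i j) (suc D)) (Σ<-cong (suc D) λ t _ →
  count-[_] (InI? D) (i , j , t))))
  where
  point : ℕ → ℕ → ℕ → List (ℕ × ℕ × ℕ)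
  point i j t = [ (i , j , t) ]
  column : ℕ → ℕ → List (ℕ × ℕ × ℕ)
  column i j = concatMap (point i j) (upTo (suc D))
  rows : ℕ → List (ℕ × ℕ × ℕ)
  rows i = concatMap (column i) (upTo (suc D))

InI-swap : ∀ D i j t → InI D (i , j , t) → InI D (j , i , t)
InI-swap D i j t (t≤i , t≤j , i≤D , j≤D , excess , edgeᵢ , edgeⱼ) =
  t≤j , t≤i , j≤D , i≤D , subst (λ s → s ∸ t ≤ 2 * D ∸ 2) (+-comm i j) excess , edgeⱼ , edgeᵢ

fibre-swap : ∀ D i j → fibre D i j ≡ fibre D j i
fibre-swap D i j = Σ<-cong (suc D) λ t _ →
  𝟙-⇔ (InI? D (i , j , t)) (InI? D (j , i , t)) (mk⇔ (InI-swap D i j t) (InI-swap D j i t))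

fibre-interval : ∀ {D i j} a b → b ≤ D → (∀ t → InI D (i , j , t) ⇔ (a ≤ t × t ≤ b)) →
  fibre D i j ≡ suc b ∸ a
fibre-interval {D} {i} {j} a b b≤D fibre⇔interval = begin
    fibre D i j                          ≡⟨ Σ<-cong (suc D) (λ t _ → 𝟙-⇔ (InI? D (i , j , t)) _ (fibre⇔interval t)) ⟩
    Σ< (suc D) (inInterval a b)          ≡⟨ count-interval a b (suc D) (s≤s b≤D) ⟩
    suc b ∸ a                            ∎

n/2≡⌊n/2⌋ : ∀ n → n / 2 ≡ ⌊ n /2⌋
n/2≡⌊n/2⌋ zero          = refl
n/2≡⌊n/2⌋ (suc zero)    = refl
n/2≡⌊n/2⌋ (suc (suc n)) = trans (m/n≡1+[m∸n]/n {suc (suc n)} {2} (s≤s (s≤s z≤n))) (cong suc (n/2≡⌊n/2⌋ n))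

size-upper-half : ∀ n → suc n ∸ ⌈ n /2⌉ ≡ suc ⌊ n /2⌋
size-upper-half n = begin
    suc n ∸ ⌈ n /2⌉                        ≡⟨ cong (λ m → suc m ∸ ⌈ n /2⌉) (⌊n/2⌋+⌈n/2⌉≡n n) ⟨
    suc (⌊ n /2⌋ + ⌈ n /2⌉) ∸ ⌈ n /2⌉      ≡⟨ m+n∸n≡m (suc ⌊ n /2⌋) ⌈ n /2⌉ ⟩
    suc ⌊ n /2⌋                            ∎

bound-for-suc : ∀ d → 2 * suc d ∸ 2 ≡ d + d
bound-for-suc d = cong (_∸ 2) (double d)
  where
  double : ∀ d → 2 * suc d ≡ 2 + (d + d)
  double = solve-∀

fibre-interior : ∀ d i j → i ≤ d → j ≤ d → fibre (suc d) i j ≡ suc (i ⊓ j)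
fibre-interior d i j i≤d j≤d = fibre-interval 0 (i ⊓ j) (m≤n⇒m≤1+n (≤-trans (m⊓n≤m i j) i≤d)) λ t →
  mk⇔ (λ (t≤i , t≤j , _) → z≤n , ⊓-glb t≤i t≤j)
      (λ (_ , t≤i⊓j) → ≤-trans t≤i⊓j (m⊓n≤m i j) , ≤-trans t≤i⊓j (m⊓n≤n i j)
                      , m≤n⇒m≤1+n i≤d , m≤n⇒m≤1+n j≤d
                      , ≤-trans (m∸n≤m (i + j) t) (subst (i + j ≤_) (sym (bound-for-suc d)) (+-mono-≤ i≤d j≤d))
                      , (λ i≡D → ⊥-elim (<⇒≢ (s≤s i≤d) i≡D)) , (λ j≡D → ⊥-elim (<⇒≢ (s≤s j≤d) j≡D)))

edge-excess : ∀ d j t → 1 ≤ d → j ≤ d → ⌈ j /2⌉ ≤ t → suc d + j ∸ t ≤ 2 * suc d ∸ 2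
edge-excess d j t 1≤d j≤d ⌈j/2⌉≤t =
  subst (suc d + j ∸ t ≤_) (sym (bound-for-suc d)) (m≤n+o⇒m∸n≤o (suc d + j) t (sum-bound j j≤d ⌈j/2⌉≤t))
  where
  sum-bound : ∀ j → j ≤ d → ⌈ j /2⌉ ≤ t → suc d + j ≤ t + (d + d)
  sum-bound zero    _   _  = ≤-trans (≤-reflexive (+-identityʳ (suc d)))
                           (≤-trans (+-monoˡ-≤ d 1≤d) (m≤n+m (d + d) t))
  sum-bound (suc j) j<d ⌈j/2⌉≤t = +-mono-≤ (≤-trans (s≤s z≤n) ⌈j/2⌉≤t) (+-monoʳ-≤ d j<d)

fibre-edge : ∀ d j → 1 ≤ d → j ≤ d → fibre (suc d) (suc d) j ≡ suc ⌊ j /2⌋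
fibre-edge d j 1≤d j≤d = trans (fibre-interval ⌈ j /2⌉ j (m≤n⇒m≤1+n j≤d) λ t →
  mk⇔ (λ (_ , t≤j , _ , _ , _ , onEdge , _) → subst (_≤ t) (n/2≡⌊n/2⌋ (suc j)) (onEdge refl) , t≤j)
      (λ (⌈j/2⌉≤t , t≤j) → ≤-trans t≤j (m≤n⇒m≤1+n j≤d) , t≤j , ≤-refl , m≤n⇒m≤1+n j≤d
                          , edge-excess d j t 1≤d j≤d ⌈j/2⌉≤t
                          , (λ _ → subst (_≤ t) (sym (n/2≡⌊n/2⌋ (suc j))) ⌈j/2⌉≤t)
                          , (λ j≡D → ⊥-elim (<⇒≢ (s≤s j≤d) j≡D))))
  (size-upper-half j)

-- The corner fibre (i = j = D) is the interval [⌈D/2⌉ , D]; here D ≥ 3 is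
-- what makes ⌈D/2⌉ ≥ 2, i.e. the excess bound automatic.
fibre-corner : ∀ d → 2 ≤ d → fibre (suc d) (suc d) (suc d) ≡ suc ⌊ suc d /2⌋
fibre-corner d 2≤d = trans (fibre-interval ⌈ suc d /2⌉ (suc d) ≤-refl λ t →
  mk⇔ (λ (t≤D , _ , _ , _ , _ , onEdge , _) → subst (_≤ t) (n/2≡⌊n/2⌋ (suc (suc d))) (onEdge refl) , t≤D)
      (λ (⌈D/2⌉≤t , t≤D) → t≤D , t≤D , ≤-refl , ≤-refl , excess t (≤-trans 2≤⌈D/2⌉ ⌈D/2⌉≤t)
                          , (λ _ → subst (_≤ t) (sym (n/2≡⌊n/2⌋ (suc (suc d)))) ⌈D/2⌉≤t)
                          , (λ _ → subst (_≤ t) (sym (n/2≡⌊n/2⌋ (suc (suc d)))) ⌈D/2⌉≤t)))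
  (size-upper-half (suc d))
  where
  2≤⌈D/2⌉ : 2 ≤ ⌈ suc d /2⌉
  2≤⌈D/2⌉ = s≤s (⌊n/2⌋-mono 2≤d)
  excess : ∀ t → 2 ≤ t → suc d + suc d ∸ t ≤ 2 * suc d ∸ 2
  excess t 2≤t = ≤-trans (∸-monoʳ-≤ (suc d + suc d) 2≤t)
                         (≤-reflexive (cong (λ m → suc d + m ∸ 2) (sym (+-identityʳ (suc d)))))

minSum : ℕ → ℕ
minSum n = Σ< n (λ i → Σ< n (λ j → suc (i ⊓ j)))

halfSum : ℕ → ℕ
halfSum n = Σ< n (λ j → suc ⌊ j /2⌋)

sum-of-fibres : ∀ d → 2 ≤ d → let D = suc d in
  Σ< (suc D) (λ i → Σ< (suc D) (fibre D i)) ≡ (minSum D + halfSum D) + (halfSum D + suc ⌊ D /2⌋)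
sum-of-fibres d 2≤d = cong₂ _+_
  (trans (Σ<-cong (suc d) λ i i<D → cong₂ _+_
            (Σ<-cong (suc d) λ j j<D → fibre-interior d i j (s≤s⁻¹ i<D) (s≤s⁻¹ j<D))
            (trans (fibre-swap (suc d) i (suc d)) (fibre-edge d i 1≤d (s≤s⁻¹ i<D))))
         (Σ<-+ (suc d) (λ i → Σ< (suc d) (λ j → suc (i ⊓ j))) (λ i → suc ⌊ i /2⌋)))
  (cong₂ _+_ (Σ<-cong (suc d) λ j j<D → fibre-edge d j 1≤d (s≤s⁻¹ j<D))
             (fibre-corner d 2≤d))
  where
  1≤d : 1 ≤ d
  1≤d = ≤-trans (s≤s z≤n) 2≤d

minSum-suc : ∀ n → minSum (suc n) ≡ (minSum n + Σ< n suc) + (Σ< n suc + suc n)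
minSum-suc n = cong₂ _+_
  (trans (Σ<-+ n (λ i → Σ< n (λ j → suc (i ⊓ j))) (λ i → suc (i ⊓ n)))
         (cong (minSum n +_) (Σ<-cong n λ i i<n → cong suc (m≤n⇒m⊓n≡m (<⇒≤ i<n)))))
  (cong₂ _+_ (Σ<-cong n λ j j<n → cong suc (m≥n⇒m⊓n≡n (<⇒≤ j<n))) (cong suc (⊓-idem n)))

minSum-closed : ∀ n → 6 * minSum n ≡ n * suc n * suc (2 * n)
minSum-closed zero    = refl
minSum-closed (suc n) = begin
    6 * minSum (suc n)                                     ≡⟨ cong (6 *_) (minSum-suc n) ⟩
    6 * ((minSum n + Σ< n suc) + (Σ< n suc + suc n))       ≡⟨ regroup (minSum n) (Σ< n suc) n ⟩
    6 * minSum n + 6 * (2 * Σ< n suc) + 6 * suc n          ≡⟨ cong₂ (λ x y → x + 6 * y + 6 * suc n) (minSum-closed n) (gauss n) ⟩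
    n * suc n * suc (2 * n) + 6 * (n * suc n) + 6 * suc n  ≡⟨ expand n ⟩
    suc n * suc (suc n) * suc (2 * suc n)                  ∎
  where
  regroup : ∀ m s n → 6 * ((m + s) + (s + suc n)) ≡ 6 * m + 6 * (2 * s) + 6 * suc n
  regroup = solve-∀
  expand : ∀ n → n * suc n * suc (2 * n) + 6 * (n * suc n) + 6 * suc n ≡ suc n * suc (suc n) * suc (2 * suc n)
  expand = solve-∀

halfSum-closed : ∀ n → 2 * (2 * halfSum n + ⌊ n /2⌋) ≡ n * n + 3 * n
halfSum-closed zero    = refl
halfSum-closed (suc n) = begin
    2 * (2 * (halfSum n + suc ⌊ n /2⌋) + ⌊ suc n /2⌋)                  ≡⟨ regroup (halfSum n) ⌊ n /2⌋ ⌊ suc n /2⌋ ⟩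
    2 * (2 * halfSum n + ⌊ n /2⌋) + 2 * (2 + (⌊ n /2⌋ + ⌈ n /2⌉))     ≡⟨ cong₂ (λ x y → x + 2 * (2 + y)) (halfSum-closed n) (⌊n/2⌋+⌈n/2⌉≡n n) ⟩
    n * n + 3 * n + 2 * (2 + n)                                         ≡⟨ expand n ⟩
    suc n * suc n + 3 * suc n                                           ∎
  where
  regroup : ∀ s h h′ → 2 * (2 * (s + suc h) + h′) ≡ 2 * (2 * s + h) + 2 * (2 + (h + h′))
  regroup = solve-∀
  expand : ∀ n → n * n + 3 * n + 2 * (2 + n) ≡ suc n * suc n + 3 * suc n
  expand = solve-∀

proposition3p1 : (D : ℕ) → 3 ≤ D →
    3 * length (𝓘 D) ≡ (D + 1) * (D * D + 2 * D + 3)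
proposition3p1 D@(suc d) (s≤s 2≤d) = *-cancelˡ-≡ _ _ 2 (begin
    2 * (3 * length (𝓘 D))                                       ≡⟨ cong (λ n → 2 * (3 * n)) (length-𝓘 D) ⟩
    2 * (3 * Σ< (suc D) (λ i → Σ< (suc D) (fibre D i)))          ≡⟨ cong (λ n → 2 * (3 * n)) (sum-of-fibres d 2≤d) ⟩
    2 * (3 * ((minSum D + halfSum D) + (halfSum D + suc ⌊ D /2⌋))) ≡⟨ regroup (minSum D) (halfSum D) ⌊ D /2⌋ ⟩
    6 * minSum D + 3 * (2 * (2 * halfSum D + ⌊ D /2⌋)) + 6       ≡⟨ cong₂ (λ x y → x + 3 * y + 6) (minSum-closed D) (halfSum-closed D) ⟩
    D * suc D * suc (2 * D) + 3 * (D * D + 3 * D) + 6            ≡⟨ expand D ⟩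
    2 * ((D + 1) * (D * D + 2 * D + 3))                          ∎)
  where
  regroup : ∀ m s h → 2 * (3 * ((m + s) + (s + suc h))) ≡ 6 * m + 3 * (2 * (2 * s + h)) + 6
  regroup = solve-∀
  expand : ∀ D → D * suc D * suc (2 * D) + 3 * (D * D + 3 * D) + 6 ≡ 2 * ((D + 1) * (D * D + 2 * D + 3))
  expand = solve-∀
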